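{- Let $p$ be an odd prime and $h$ a positive integer with $p\equiv 1\pmod{2h}$. Then $$g\Big(\tfrac{p-1}{2h},\,p\Big)\ \ge\ \tfrac12\sqrt[h]{h!\,p}-\tfrac{h+1}{2}.$$ In particular, if $\sqrt[h]{h!\,p}>h+1$, then $g(\tfrac{p-1}{2h},p)\ge\big\lceil \tfrac12\sqrt[h]{h!\,p}-\tfrac{h+1}{2}\big\rceil$.
   Context: For a prime $p$ and a positive integer $k\mid p-1$, the Waring number $g(k,p)$ is the least positive integer $s$ such that every element of $\mathbb{F}_p$ can be written as $x_1^k+\cdots+x_s^k$ with $x_i\in\mathbb{F}_p$ (it always exists in this case). -}

module Defs where

open import Data.Nat using (ℕ; _+_; _*_; _^_; _<_; _≤_)
open import Data.Vec using (Vec; map; sum)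
open import Data.Product using (∃; _×_)
open import Relation.Nullary using (¬_)
open import Relation.Binary.PropositionalEquality using (_≡_)

_≡_[mod_] : ℕ → ℕ → ℕ → Set
a ≡ b [mod p ] = ∃ λ m → ∃ λ n → a + m * p ≡ b + n * p

-- the residue a (an element of F_p, represented by 0 ≤ a < p) is a sum of
-- s k-th powers x_1^k + ... + x_s^k of elements of F_p
SumOfPowers : (k p s a : ℕ) → Set
SumOfPowers k p s a = ∃ λ (x : Vec ℕ s) → sum (map (λ y → y ^ k) x) ≡ a [mod p ]

EveryElementSumOf : (k p s : ℕ) → Set
EveryElementSumOf k p s = ∀ a → a < p → SumOfPowers k p s a

IsWaringNumber : (k p g : ℕ) → Set
IsWaringNumber k p g =
  1 ≤ g × EveryElementSumOf k p g × (∀ s → 1 ≤ s → s < g → ¬ EveryElementSumOf k p s)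

-- Put N = 2h, so that k = (p − 1)/N.  By Fermat's little theorem every k-th power
-- is 0 or a root of y^N ≡ 1 (mod p).  As N is even, those roots are ±u for u in the
-- set U of roots in [1, (p − 1)/2], and Lagrange's bound on the roots of y^N − 1
-- gives 2|U| ≤ N.  A sum of g k-th powers is therefore congruent to Σ c_u u with
-- integer coefficients and Σ |c_u| ≤ g.  If all p residues arise this way, p is at
-- most the number of lattice points in the ℓ₁-ball of radius g in ℤ^h, and a
-- telescoping estimate bounds h! times that number by (2g + h + 1)^h.
module Submission where

open import Data.Nat.Base as ℕ using (ℕ; zero; suc; NonZero)
open import Data.Nat.Primality using (Prime)
open import Relation.Binary.PropositionalEquality using (_≡_)

module LatticePointCount where

  open import Data.Nat
  open import Data.Nat.Properties
  open import Data.Nat.Tactic.RingSolver using (solve-∀)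
  open import Relation.Binary.PropositionalEquality using (_≡_; trans; cong)

  prefixSum : (ℕ → ℕ) → ℕ → ℕ
  prefixSum f zero    = 0
  prefixSum f (suc b) = f b + prefixSum f b

  *-distribˡ-prefixSum : ∀ c f n → c * prefixSum f n ≡ prefixSum (λ b → c * f b) n
  *-distribˡ-prefixSum c f zero    = *-zeroʳ c
  *-distribˡ-prefixSum c f (suc n) =
    trans (*-distribˡ-+ c (f n) _) (cong (c * f n +_) (*-distribˡ-prefixSum c f n))

  -- The number of c ∈ ℤⁿ with ∣c₁∣ + ⋯ + ∣cₙ∣ ≤ G: either c₁ = 0, or ∣c₁∣ = G ∸ b for
  -- some b < G (two signs) and the remaining coordinates lie in the ball of radius b.
  ballSize : ℕ → ℕ → ℕ
  ballSize zero    G = 1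
  ballSize (suc n) G = ballSize n G + 2 * prefixSum (ballSize n) G

  ballSize-monoˡ : ∀ {m n} G → m ≤ n → ballSize m G ≤ ballSize n G
  ballSize-monoˡ {m} G m≤n = go (≤⇒≤′ m≤n)
    where
    go : ∀ {n} → m ≤′ n → ballSize m G ≤ ballSize n G
    go ≤′-refl        = ≤-refl
    go (≤′-step m≤′n) = ≤-trans (go m≤′n) (m≤m+n _ _)

  [1+m]^[1+n]≤m^[1+n]+[1+n]*[1+m]^n : ∀ m n → suc m ^ suc n ≤ m ^ suc n + suc n * suc m ^ n
  [1+m]^[1+n]≤m^[1+n]+[1+n]*[1+m]^n m zero    = ≤-reflexive (+-comm 1 (m * 1))
  [1+m]^[1+n]≤m^[1+n]+[1+n]*[1+m]^n m (suc n) = begin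
    suc m * C                    ≤⟨ *-monoʳ-≤ (suc m) ([1+m]^[1+n]≤m^[1+n]+[1+n]*[1+m]^n m n) ⟩
    suc m * (A + suc n * B)      ≡⟨ expand m A B n ⟩
    m * A + A + suc n * C        ≤⟨ +-monoˡ-≤ (suc n * C) (+-monoʳ-≤ (m * A) (^-monoˡ-≤ (suc n) (n≤1+n m))) ⟩
    m * A + C + suc n * C        ≡⟨ collect m A C n ⟩
    m * A + suc (suc n) * C      ∎
    where
    open ≤-Reasoning
    A = m ^ suc n
    B = suc m ^ n
    C = suc m ^ suc n
    expand : ∀ m A B n → (1 + m) * (A + (1 + n) * B) ≡ m * A + A + (1 + n) * ((1 + m) * B)
    expand = solve-∀
    collect : ∀ m A C n → m * A + C + (1 + n) * C ≡ m * A + (2 + n) * C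
    collect = solve-∀

  m^[1+n]+2*[1+n]*[1+m]^n≤[2+m]^[1+n] : ∀ m n → m ^ suc n + 2 * suc n * suc m ^ n ≤ (2 + m) ^ suc n
  m^[1+n]+2*[1+n]*[1+m]^n≤[2+m]^[1+n] m zero    = ≤-reflexive (+-comm (m * 1) 2)
  m^[1+n]+2*[1+n]*[1+m]^n≤[2+m]^[1+n] m (suc n) = begin
    m * A + 2 * (2 + n) * (suc m * B)                ≡⟨ split m A B n ⟩
    m * A + 2 * suc n * (suc m * B) + 2 * (suc m * B) ≤⟨ +-monoʳ-≤ (m * A + 2 * suc n * (suc m * B))
                                                          (*-monoʳ-≤ 2 ([1+m]^[1+n]≤m^[1+n]+[1+n]*[1+m]^n m n)) ⟩
    m * A + 2 * suc n * (suc m * B) + 2 * (A + suc n * B) ≡⟨ factor m A B n ⟩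
    (2 + m) * (A + 2 * suc n * B)                     ≤⟨ *-monoʳ-≤ (2 + m) (m^[1+n]+2*[1+n]*[1+m]^n≤[2+m]^[1+n] m n) ⟩
    (2 + m) * (2 + m) ^ suc n                         ∎
    where
    open ≤-Reasoning
    A = m ^ suc n
    B = suc m ^ n
    split : ∀ m A B n → m * A + 2 * (2 + n) * ((1 + m) * B) ≡ m * A + 2 * (1 + n) * ((1 + m) * B) + 2 * ((1 + m) * B)
    split = solve-∀
    factor : ∀ m A B n → m * A + 2 * (1 + n) * ((1 + m) * B) + 2 * (A + (1 + n) * B) ≡ (2 + m) * (A + 2 * (1 + n) * B)
    factor = solve-∀

  2*[1+n]*prefixSum≤[2G+n]^[1+n] : ∀ n f → (∀ b → f b ≤ (2 * b + n + 1) ^ n) →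
                       ∀ G → 2 * suc n * prefixSum f G ≤ (2 * G + n) ^ suc n
  2*[1+n]*prefixSum≤[2G+n]^[1+n] n f f≤ zero    = ≤-trans (≤-reflexive (*-zeroʳ (2 * suc n))) z≤n
  2*[1+n]*prefixSum≤[2G+n]^[1+n] n f f≤ (suc G) = begin
    2 * suc n * (f G + prefixSum f G)                       ≡⟨ *-distribˡ-+ (2 * suc n) (f G) _ ⟩
    2 * suc n * f G + 2 * suc n * prefixSum f G             ≤⟨ +-mono-≤ (*-monoʳ-≤ (2 * suc n) (f≤ G))
                                                                        (2*[1+n]*prefixSum≤[2G+n]^[1+n] n f f≤ G) ⟩
    2 * suc n * (2 * G + n + 1) ^ n + (2 * G + n) ^ suc n   ≡⟨ shift G n ⟩
    (2 * G + n) ^ suc n + 2 * suc n * suc (2 * G + n) ^ n   ≤⟨ m^[1+n]+2*[1+n]*[1+m]^n≤[2+m]^[1+n] (2 * G + n) n ⟩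
    (2 + (2 * G + n)) ^ suc n                               ≡⟨ cong (_^ suc n) (reassoc G n) ⟩
    (2 * suc G + n) ^ suc n                                 ∎
    where
    open ≤-Reasoning
    reassoc : ∀ G n → 2 + (2 * G + n) ≡ 2 * (1 + G) + n
    reassoc = solve-∀
    shift : ∀ G n → 2 * suc n * (2 * G + n + 1) ^ n + (2 * G + n) ^ suc n ≡ (2 * G + n) ^ suc n + 2 * suc n * suc (2 * G + n) ^ n
    shift G n = trans (+-comm (2 * suc n * (2 * G + n + 1) ^ n) _)
                      (cong (λ x → (2 * G + n) ^ suc n + 2 * suc n * x ^ n) (+-comm (2 * G + n) 1))

  n!*ballSize≤[2G+n+1]^n : ∀ n G → n ! * ballSize n G ≤ (2 * G + n + 1) ^ n
  n!*ballSize≤[2G+n+1]^n zero    G = ≤-refl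
  n!*ballSize≤[2G+n+1]^n (suc n) G = begin
    suc n ! * (L + 2 * S)                                  ≤⟨ *-monoʳ-≤ (suc n !) (+-monoˡ-≤ (2 * S) (m≤m+n L L)) ⟩
    suc n * n ! * (L + L + 2 * S)                          ≡⟨ regroup (suc n) (n !) L S ⟩
    2 * suc n * (n ! * prefixSum (ballSize n) (suc G))    ≡⟨ cong (2 * suc n *_) (*-distribˡ-prefixSum (n !) (ballSize n) (suc G)) ⟩
    2 * suc n * prefixSum (λ b → n ! * ballSize n b) (suc G)
      ≤⟨ 2*[1+n]*prefixSum≤[2G+n]^[1+n] n _ (n!*ballSize≤[2G+n+1]^n n) (suc G) ⟩
    (2 * suc G + n) ^ suc n                                ≡⟨ cong (_^ suc n) (reassoc G n) ⟩
    (2 * G + suc n + 1) ^ suc n                            ∎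
    where
    open ≤-Reasoning
    L = ballSize n G
    S = prefixSum (ballSize n) G
    regroup : ∀ a F L S → a * F * (L + L + 2 * S) ≡ 2 * a * (F * (L + S))
    regroup = solve-∀
    reassoc : ∀ G n → 2 * (1 + G) + n ≡ 2 * G + (1 + n) + 1
    reassoc = solve-∀

module IntegerVectors where

  open import Data.Nat as ℕ using (_∸_; _≤_; _<_; z≤n; s≤s)
  import Data.Nat.Properties as ℕ
  open import Data.Nat.Tactic.RingSolver using (solve-∀)
  open import Data.Integer using (ℤ; 0ℤ; ∣_∣; sign; _◃_; _+_; _*_)
  open import Data.Integer.Properties using (◃-inverse; ∣i∣≡0⇒i≡0; ∣i+j∣≤∣i∣+∣j∣; +-assoc; +-identityˡ)
  import Data.Integer.Tactic.RingSolver as ℤ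
  open import Data.Sign using (Sign)
  open import Data.Fin using (Fin; zero; suc)
  open import Data.List using (List; []; _∷_; [_]; map; _++_; length)
  open import Data.List.Properties using (length-++; length-map)
  open import Data.List.Membership.Propositional using (_∈_)
  open import Data.List.Membership.Propositional.Properties using (∈-map⁺; ∈-++⁺ˡ; ∈-++⁺ʳ)
  open import Data.List.Relation.Unary.Any using (here)
  open import Data.Vec using (Vec; []; _∷_; updateAt; replicate)
  import Data.Vec as Vec
  open import Function using (_∘_)
  open import Relation.Nullary using (yes; no)
  open import Relation.Binary.PropositionalEquality using (_≡_; refl; sym; trans; cong; cong₂; subst; module ≡-Reasoning)
  open LatticePointCount using (prefixSum; ballSize)

  norm₁ : ∀ {n} → Vec ℤ n → ℕ
  norm₁ c = Vec.sum (Vec.map ∣_∣ c)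

  norm₁-replicate-0 : ∀ n → norm₁ (replicate n 0ℤ) ≡ 0
  norm₁-replicate-0 zero    = refl
  norm₁-replicate-0 (suc n) = norm₁-replicate-0 n

  norm₁-updateAt : ∀ {n} (c : Vec ℤ n) i s → norm₁ (updateAt c i (_+ s)) ≤ norm₁ c ℕ.+ ∣ s ∣
  norm₁-updateAt (c ∷ cs) zero    s = begin
    ∣ c + s ∣ ℕ.+ norm₁ cs         ≤⟨ ℕ.+-monoˡ-≤ (norm₁ cs) (∣i+j∣≤∣i∣+∣j∣ c s) ⟩
    ∣ c ∣ ℕ.+ ∣ s ∣ ℕ.+ norm₁ cs   ≡⟨ swap (∣ c ∣) (∣ s ∣) (norm₁ cs) ⟩
    ∣ c ∣ ℕ.+ norm₁ cs ℕ.+ ∣ s ∣   ∎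
    where
    open ℕ.≤-Reasoning
    swap : ∀ a b n → a ℕ.+ b ℕ.+ n ≡ a ℕ.+ n ℕ.+ b
    swap = solve-∀
  norm₁-updateAt (c ∷ cs) (suc i) s = begin
    ∣ c ∣ ℕ.+ norm₁ (updateAt cs i (_+ s)) ≤⟨ ℕ.+-monoʳ-≤ (∣ c ∣) (norm₁-updateAt cs i s) ⟩
    ∣ c ∣ ℕ.+ (norm₁ cs ℕ.+ ∣ s ∣)        ≡⟨ ℕ.+-assoc (∣ c ∣) (norm₁ cs) (∣ s ∣) ⟨
    ∣ c ∣ ℕ.+ norm₁ cs ℕ.+ ∣ s ∣          ∎
    where open ℕ.≤-Reasoning

  combination : ∀ {n} → Vec ℤ n → (Fin n → ℤ) → ℤ
  combination []       u = 0ℤ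
  combination (c ∷ cs) u = c * u zero + combination cs (u ∘ suc)

  combination-replicate-0 : ∀ n (u : Fin n → ℤ) → combination (replicate n 0ℤ) u ≡ 0ℤ
  combination-replicate-0 zero    u = refl
  combination-replicate-0 (suc n) u = trans (+-identityˡ _) (combination-replicate-0 n (u ∘ suc))

  combination-updateAt : ∀ {n} (c : Vec ℤ n) i s u →
                         combination (updateAt c i (_+ s)) u ≡ combination c u + s * u i
  combination-updateAt (c ∷ cs) zero    s u = expand c s (u zero) (combination cs (u ∘ suc))
    where
    expand : ∀ c s x r → (c + s) * x + r ≡ c * x + r + s * x
    expand = ℤ.solve-∀
  combination-updateAt (c ∷ cs) (suc i) s u =
    trans (cong (λ r → c * u zero + r) (combination-updateAt cs i s (u ∘ suc))) (sym (+-assoc (c * u zero) _ _))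

  module _ {n} (B : ℕ → List (Vec ℤ n)) (G : ℕ) where

    layer : Sign → ℕ → List (Vec ℤ (suc n))
    layer σ b = map ((σ ◃ (G ∸ b)) ∷_) (B b)

    layers : ℕ → List (Vec ℤ (suc n))
    layers zero    = []
    layers (suc b) = layer Sign.+ b ++ layer Sign.- b ++ layers b

    length-layers : ∀ {f} → (∀ b → length (B b) ≡ f b) → ∀ b → length (layers b) ≡ 2 ℕ.* prefixSum f b
    length-layers eq zero    = refl
    length-layers {f} eq (suc b) = begin
      length (layer Sign.+ b ++ layer Sign.- b ++ layers b)   ≡⟨ length-++ (layer Sign.+ b) ⟩
      length (layer Sign.+ b) ℕ.+ length (layer Sign.- b ++ layers b)
        ≡⟨ cong (length (layer Sign.+ b) ℕ.+_) (length-++ (layer Sign.- b)) ⟩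
      length (layer Sign.+ b) ℕ.+ (length (layer Sign.- b) ℕ.+ length (layers b))
        ≡⟨ cong₂ ℕ._+_ (length-layer Sign.+) (cong₂ ℕ._+_ (length-layer Sign.-) (length-layers eq b)) ⟩
      f b ℕ.+ (f b ℕ.+ 2 ℕ.* prefixSum f b)                   ≡⟨ double (f b) (prefixSum f b) ⟩
      2 ℕ.* prefixSum f (suc b)                              ∎
      where
      open ≡-Reasoning
      length-layer : ∀ σ → length (layer σ b) ≡ f b
      length-layer σ = trans (length-map _ (B b)) (eq b)
      double : ∀ x s → x ℕ.+ (x ℕ.+ 2 ℕ.* s) ≡ 2 ℕ.* (x ℕ.+ s)
      double = solve-∀

    ∈-layers : ∀ σ {b b′ v} → b′ < b → v ∈ B b′ → ((σ ◃ (G ∸ b′)) ∷ v) ∈ layers b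
    ∈-layers σ {suc b} {b′} b′<b v∈ with b′ ℕ.≟ b
    ∈-layers Sign.+ {suc b} b′<b v∈ | yes refl = ∈-++⁺ˡ (∈-map⁺ _ v∈)
    ∈-layers Sign.- {suc b} b′<b v∈ | yes refl = ∈-++⁺ʳ (layer Sign.+ b) (∈-++⁺ˡ (∈-map⁺ _ v∈))
    ... | no b′≢b = ∈-++⁺ʳ (layer Sign.+ b) (∈-++⁺ʳ (layer Sign.- b)
                      (∈-layers σ (ℕ.≤∧≢⇒< (ℕ.≤-pred b′<b) b′≢b) v∈))

  ball : ∀ n → ℕ → List (Vec ℤ n)
  ball zero    G = [ [] ]
  ball (suc n) G = map (0ℤ ∷_) (ball n G) ++ layers (ball n) G G

  length-ball : ∀ n G → length (ball n G) ≡ ballSize n G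
  length-ball zero    G = refl
  length-ball (suc n) G = begin
    length (map (0ℤ ∷_) (ball n G) ++ layers (ball n) G G)          ≡⟨ length-++ (map (0ℤ ∷_) (ball n G)) ⟩
    length (map (0ℤ ∷_) (ball n G)) ℕ.+ length (layers (ball n) G G)
      ≡⟨ cong₂ ℕ._+_ (trans (length-map _ (ball n G)) (length-ball n G)) (length-layers (ball n) G (length-ball n) G) ⟩
    ballSize (suc n) G                                              ∎
    where open ≡-Reasoning

  ∈-ball : ∀ {n G} (c : Vec ℤ n) → norm₁ c ≤ G → c ∈ ball n G
  ∈-ball [] _ = here refl
  ∈-ball {suc n} {G} (c ∷ w) bound with ∣ c ∣ in ∣c∣≡
  ... | zero  = ∈-++⁺ˡ (subst (λ x → (x ∷ w) ∈ map (0ℤ ∷_) (ball n G)) (sym (∣i∣≡0⇒i≡0 ∣c∣≡))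
                         (∈-map⁺ _ (∈-ball w bound)))
  ... | suc j = ∈-++⁺ʳ (map (0ℤ ∷_) (ball n G))
                  (subst (λ x → (x ∷ w) ∈ layers (ball n) G G) c≡ (∈-layers (ball n) G (sign c) b′<G (∈-ball w w≤)))
    where
    j≤G : suc j ≤ G
    j≤G = ℕ.m+n≤o⇒m≤o (suc j) bound
    b′<G : G ∸ suc j < G
    b′<G = ℕ.∸-monoʳ-< (s≤s z≤n) j≤G
    w≤ : norm₁ w ≤ G ∸ suc j
    w≤ = ℕ.m+n≤o⇒m≤o∸n (norm₁ w) (subst (_≤ G) (ℕ.+-comm (suc j) (norm₁ w)) bound)
    c≡ : sign c ◃ (G ∸ (G ∸ suc j)) ≡ c
    c≡ = trans (cong (sign c ◃_) (trans (ℕ.m∸[m∸n]≡n j≤G) (sym ∣c∣≡))) (◃-inverse c)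

module IntegerArithmetic where

  open import Data.Nat as ℕ using (_<_; _≤_)
  import Data.Nat.Properties as ℕ
  import Data.Nat.Divisibility as ℕ
  open import Data.Nat.DivMod using (_%_; _/_; m≡m%n+[m/n]*n)
  open import Data.Integer using (ℤ; +_; 0ℤ; 1ℤ; -1ℤ; -_; _+_; _-_; _*_; _^_; ∣_∣)
  open import Data.Integer.Properties
    using (pos-+; pos-*; m-n≡m⊖n; ⊖-≥; +-inverseʳ; +-identityʳ; ^-*-assoc; *-identityˡ; -1*i≡-i)
  open import Data.Integer.Divisibility.Signed
  import Data.Integer.Tactic.RingSolver as ℤ
  open import Data.Product using (∃; _×_; _,_)
  open import Data.Sum using (_⊎_; inj₁; inj₂)
  open import Function using (_∘_)
  open import Level using (0ℓ)
  open import Relation.Binary.Bundles using (Setoid)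
  open import Relation.Binary.PropositionalEquality using (refl; sym; trans; cong; subst; module ≡-Reasoning)
  open import Relation.Nullary using (¬_; contradiction; Dec)
  import Relation.Nullary.Decidable as Dec
  open import Defs using (_≡_[mod_])

  -i^[2n]≡i^[2n] : ∀ i n → (- i) ^ (2 ℕ.* n) ≡ i ^ (2 ℕ.* n)
  -i^[2n]≡i^[2n] i n = begin
    (- i) ^ (2 ℕ.* n)  ≡⟨ ^-*-assoc (- i) 2 n ⟨
    ((- i) ^ 2) ^ n    ≡⟨ cong (_^ n) (square i) ⟩
    (i ^ 2) ^ n        ≡⟨ ^-*-assoc i 2 n ⟩
    i ^ (2 ℕ.* n)      ∎
    where
    open ≡-Reasoning
    square : ∀ i → (- i) * ((- i) * 1ℤ) ≡ i * (i * 1ℤ)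
    square = ℤ.solve-∀

  pos-^ : ∀ m n → + (m ℕ.^ n) ≡ (+ m) ^ n
  pos-^ m zero    = refl
  pos-^ m (suc n) = trans (pos-* m (m ℕ.^ n)) (cong (+ m *_) (pos-^ m n))

  0^n≡0 : ∀ n .{{_ : NonZero n}} → 0ℤ ^ n ≡ 0ℤ
  0^n≡0 (suc n) = refl

  pos-∸ : ∀ {m n} → n ≤ m → + m - + n ≡ + (m ℕ.∸ n)
  pos-∸ {m} {n} n≤m = trans (m-n≡m⊖n m n) (⊖-≥ n≤m)

  module Congruence (p : ℕ) where

    infix 4 _≈_ _≉_ _≈?_

    record _≈_ (a b : ℤ) : Set where
      constructor divides-diff
      field ∣diff : + p ∣ a - b

    _≉_ : ℤ → ℤ → Set
    a ≉ b = ¬ a ≈ b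

    open _≈_ public

    private
      ∣-by : ∀ {x y} → x ≡ y → + p ∣ x → + p ∣ y
      ∣-by eq = subst (+ p ∣_) eq

      ≈-by : ∀ {x a b} → x ≡ a - b → + p ∣ x → a ≈ b
      ≈-by eq = divides-diff ∘ ∣-by eq

    ≈-reflexive : ∀ {a b} → a ≡ b → a ≈ b
    ≈-reflexive {a} refl = ≈-by (sym (+-inverseʳ a)) (divides 0ℤ refl)

    ≈-refl : ∀ {a} → a ≈ a
    ≈-refl = ≈-reflexive refl

    ≈-sym : ∀ {a b} → a ≈ b → b ≈ a
    ≈-sym {a} {b} (divides-diff d) = ≈-by (flip a b) (∣m⇒∣-m d)
      where
      flip : ∀ a b → - (a - b) ≡ b - a
      flip = ℤ.solve-∀

    ≈-trans : ∀ {a b c} → a ≈ b → b ≈ c → a ≈ c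
    ≈-trans {a} {b} {c} (divides-diff d) (divides-diff e) = ≈-by (chain a b c) (∣m∣n⇒∣m+n d e)
      where
      chain : ∀ a b c → (a - b) + (b - c) ≡ a - c
      chain = ℤ.solve-∀

    _≈?_ : ∀ a b → Dec (a ≈ b)
    a ≈? b = Dec.map′ divides-diff ∣diff (+ p ∣? a - b)

    ≈0⇒∣ : ∀ {a} → a ≈ 0ℤ → + p ∣ a
    ≈0⇒∣ {a} = ∣-by (+-identityʳ a) ∘ ∣diff

    ∣⇒≈0 : ∀ {a} → + p ∣ a → a ≈ 0ℤ
    ∣⇒≈0 {a} = ≈-by (sym (+-identityʳ a))

    ≈⇒-≈0 : ∀ {a b} → a ≈ b → a - b ≈ 0ℤ
    ≈⇒-≈0 = ∣⇒≈0 ∘ ∣diff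

    -≈0⇒≈ : ∀ {a b} → a - b ≈ 0ℤ → a ≈ b
    -≈0⇒≈ = divides-diff ∘ ≈0⇒∣

    ≈-setoid : Setoid 0ℓ 0ℓ
    ≈-setoid = record
      { Carrier       = ℤ
      ; _≈_           = _≈_
      ; isEquivalence = record { refl = ≈-refl ; sym = ≈-sym ; trans = ≈-trans }
      }

    +-cong : ∀ {a b c d} → a ≈ b → c ≈ d → a + c ≈ b + d
    +-cong {a} {b} {c} {d} (divides-diff e) (divides-diff f) = ≈-by (regroup a b c d) (∣m∣n⇒∣m+n e f)
      where
      regroup : ∀ a b c d → (a - b) + (c - d) ≡ (a + c) - (b + d)
      regroup = ℤ.solve-∀

    *-cong : ∀ {a b c d} → a ≈ b → c ≈ d → a * c ≈ b * d
    *-cong {a} {b} {c} {d} (divides-diff e) (divides-diff f) =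
      ≈-by (regroup a b c d) (∣m∣n⇒∣m+n (∣m⇒∣m*n c e) (∣n⇒∣m*n b f))
      where
      regroup : ∀ a b c d → (a - b) * c + b * (c - d) ≡ a * c - b * d
      regroup = ℤ.solve-∀

    -‿cong : ∀ {a b} → a ≈ b → - a ≈ - b
    -‿cong {a} {b} (divides-diff e) = ≈-by (regroup a b) (∣m⇒∣-m e)
      where
      regroup : ∀ a b → - (a - b) ≡ - a - - b
      regroup = ℤ.solve-∀

    ^-cong : ∀ {a b} n → a ≈ b → a ^ n ≈ b ^ n
    ^-cong zero    a≈b = ≈-refl
    ^-cong (suc n) a≈b = *-cong a≈b (^-cong n a≈b)

    p≈0 : + p ≈ 0ℤ
    p≈0 = ∣⇒≈0 ∣-refl

    +-multiple : ∀ a k → a + k * + p ≈ a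
    +-multiple a k = ≈-by (regroup a k (+ p)) (∣n⇒∣m*n k ∣-refl)
      where
      regroup : ∀ a k p → k * p ≡ a + k * p - a
      regroup = ℤ.solve-∀

    mod⇒≈ : ∀ {a b} → a ≡ b [mod p ] → + a ≈ + b
    mod⇒≈ {a} {b} (m , n , eq) = begin
      + a                     ≈⟨ +-multiple (+ a) (+ m) ⟨
      + a + + m * + p         ≡⟨ cast a m ⟨
      + (a ℕ.+ m ℕ.* p)       ≡⟨ cong +_ eq ⟩
      + (b ℕ.+ n ℕ.* p)       ≡⟨ cast b n ⟩
      + b + + n * + p         ≈⟨ +-multiple (+ b) (+ n) ⟩
      + b                     ∎
      where
      open import Relation.Binary.Reasoning.Setoid ≈-setoid
      cast : ∀ a m → + (a ℕ.+ m ℕ.* p) ≡ + a + + m * + p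
      cast a m = trans (pos-+ a (m ℕ.* p)) (cong (λ x → + a + x) (pos-* m p))

    %-≈ : ∀ n .{{_ : NonZero p}} → + (n % p) ≈ + n
    %-≈ n = mod⇒≈ (n / p , 0 , trans (sym (m≡m%n+[m/n]*n n p)) (sym (ℕ.+-identityʳ n)))

    private
      <p∧p∣⇒≡0 : ∀ {n} → n < p → + p ∣ + n → n ≡ 0
      <p∧p∣⇒≡0 {zero}  _   _    = refl
      <p∧p∣⇒≡0 {suc n} n<p p∣n = contradiction (ℕ.∣⇒≤ (∣⇒∣ᵤ p∣n)) (ℕ.<⇒≱ n<p)

      ≈∧≥⇒≤ : ∀ {a b} → b ≤ a → a < p → + a ≈ + b → a ≤ b
      ≈∧≥⇒≤ {a} {b} b≤a a<p a≈b =
        ℕ.m∸n≡0⇒m≤n (<p∧p∣⇒≡0 (ℕ.≤-<-trans (ℕ.m∸n≤m a b) a<p) (∣-by (pos-∸ b≤a) (∣diff a≈b)))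

    ≈⇒≡ : ∀ {a b} → a < p → b < p → + a ≈ + b → a ≡ b
    ≈⇒≡ {a} {b} a<p b<p a≈b with ℕ.≤-total b a
    ... | inj₁ b≤a = ℕ.≤-antisym (≈∧≥⇒≤ b≤a a<p a≈b) b≤a
    ... | inj₂ a≤b = sym (ℕ.≤-antisym (≈∧≥⇒≤ a≤b b<p (≈-sym a≈b)) a≤b)

    ±⇒unit-multiple : ∀ {a b} → a ≈ b ⊎ a ≈ - b → ∃ λ s → ∣ s ∣ ≡ 1 × a ≈ s * b
    ±⇒unit-multiple {b = b} (inj₁ a≈b)  = 1ℤ , refl , ≈-trans a≈b (≈-reflexive (sym (*-identityˡ b)))
    ±⇒unit-multiple {b = b} (inj₂ a≈-b) = -1ℤ , refl , ≈-trans a≈-b (≈-reflexive (sym (-1*i≡-i b)))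

module BinomialCoefficients where

  open import Data.Nat using (_+_; _*_; _^_; _∸_; _<_; _≤_; _!; z≤n; s≤s)
  import Data.Nat.Properties as ℕ
  open import Data.Nat.Properties using (_!*_!≢0)
  open import Data.Nat.Divisibility as ℕ using (_∣_; _∤_; quotient)
  open import Data.Nat.DivMod using (m*[n/m]≡n)
  open import Data.Nat.Combinatorics using (_C_; nCn≡1; k![n∸k]!∣n!; nCk≡n!/k![n-k]!)
  open import Data.Nat.Primality using (euclidsLemma; prime⇒nonTrivial)
  open import Data.Fin using (Fin; zero; suc; toℕ; inject₁; fromℕ)
  open import Data.Fin.Properties using (toℕ-inject₁; toℕ-fromℕ; toℕ<n)
  open import Data.Sum using (inj₁; inj₂)
  open import Data.Product using (_,_)
  open import Function using (_∘_)
  open import Relation.Binary.PropositionalEquality using (refl; sym; trans; cong; cong₂; subst; module ≡-Reasoning)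
  open import Relation.Nullary using (contradiction)
  import Algebra.Definitions.RawMonoid as RawMonoid
  import Algebra.Definitions.RawSemiring as RawSemiring
  open import Algebra.Properties.CommutativeSemiring.Binomial ℕ.+-*-commutativeSemiring
    using (binomial; binomialTerm; theorem)
  open import Algebra.Properties.Monoid.Sum ℕ.+-0-monoid using (sum; sum-init-last)
  open import Defs using (_≡_[mod_])

  p∤m! : ∀ {p m} → Prime p → m < p → p ∤ m !
  p∤m! {p} {zero}  p-prime _   p∣1  = ℕ.<-irrefl (sym (ℕ.∣1⇒≡1 p∣1)) (ℕ.nonTrivial⇒n>1 p {{prime⇒nonTrivial p-prime}})
  p∤m! {p} {suc m} p-prime m<p p∣m! with euclidsLemma (suc m) (m !) p-prime p∣m!
  ... | inj₁ p∣1+m = ℕ.<⇒≱ m<p (ℕ.∣⇒≤ p∣1+m)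
  ... | inj₂ p∣m!  = p∤m! p-prime (ℕ.<-trans (ℕ.n<1+n m) m<p) p∣m!

  k!*[n∸k]!*nCk≡n! : ∀ {n k} → k ≤ n → k ! * (n ∸ k) ! * (n C k) ≡ n !
  k!*[n∸k]!*nCk≡n! {n} {k} k≤n = trans (cong (k ! * (n ∸ k) ! ℕ.*_) (nCk≡n!/k![n-k]! k≤n))
                                       (m*[n/m]≡n {{k !* (n ∸ k) !≢0}} (k![n∸k]!∣n! k≤n))

  p∣pCk : ∀ {p k} → Prime p → 0 < k → k < p → p ∣ p C k
  p∣pCk {p@(suc q)} {k} p-prime 0<k k<p with euclidsLemma (k ! * (p ∸ k) !) (p C k) p-prime
    (subst (p ∣_) (sym (k!*[n∸k]!*nCk≡n! (ℕ.<⇒≤ k<p))) (ℕ.m∣m*n (q !)))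
  ... | inj₂ p∣C = p∣C
  ... | inj₁ p∣d with euclidsLemma (k !) ((p ∸ k) !) p-prime p∣d
  ...   | inj₁ p∣k!     = contradiction p∣k! (p∤m! p-prime k<p)
  ...   | inj₂ p∣[p-k]! = contradiction p∣[p-k]! (p∤m! p-prime (ℕ.∸-monoʳ-< 0<k (ℕ.<⇒≤ k<p)))

  ×≡* : ∀ n y → RawMonoid._×_ ℕ.+-0-rawMonoid n y ≡ n * y
  ×≡* zero    y = refl
  ×≡* (suc n) y = cong (y +_) (×≡* n y)

  ^≡^ : ∀ y n → RawSemiring._^_ ℕ.+-*-rawSemiring y n ≡ y ^ n
  ^≡^ y zero    = refl
  ^≡^ y (suc n) = cong (y *_) (^≡^ y n)

  ∣-sum : ∀ {d n} (f : Fin n → ℕ) → (∀ i → d ∣ f i) → d ∣ sum f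
  ∣-sum {n = zero}  f d∣f = ℕ._∣0 _
  ∣-sum {n = suc n} f d∣f = ℕ.∣m∣n⇒∣m+n (d∣f zero) (∣-sum (f ∘ suc) (d∣f ∘ suc))

  [1+x]^p≡1+x^p : ∀ {p} → Prime p → ∀ x → (suc x ^ p) ≡ suc (x ^ p) [mod p ]
  [1+x]^p≡1+x^p {zero} p-prime x = contradiction (ℕ.nonTrivial⇒n>1 0 {{prime⇒nonTrivial p-prime}}) λ ()
  [1+x]^p≡1+x^p {p@(suc n)} p-prime x = 0 , quotient p∣middle , (begin
    suc x ^ p + 0                              ≡⟨ ℕ.+-identityʳ _ ⟩
    suc x ^ p                                    ≡⟨ cong (_^ p) (ℕ.+-comm 1 x) ⟩
    (x + 1) ^ p                                ≡⟨ ^≡^ (x + 1) p ⟨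
    RawSemiring._^_ ℕ.+-*-rawSemiring (x + 1) p  ≡⟨ theorem p x 1 ⟩
    T zero + sum (T ∘ suc)                       ≡⟨ cong₂ _+_ first (sum-init-last (T ∘ suc)) ⟩
    1 + (middle + T (suc (fromℕ n)))           ≡⟨ cong (λ y → 1 + (middle + y)) last ⟩
    1 + (middle + x ^ p)                     ≡⟨ cong suc (ℕ.+-comm middle _) ⟩
    suc (x ^ p + middle)                       ≡⟨ cong (λ y → suc (x ^ p + y)) (_∣_.equality p∣middle) ⟩
    suc (x ^ p) + quotient p∣middle * p      ∎)
    where
    open ≡-Reasoning
    T : Fin (suc p) → ℕ
    T = binomialTerm x 1 p
    middle : ℕ
    middle = sum (λ i → T (suc (inject₁ i)))
    p∣middle : p ∣ middle
    p∣middle = ∣-sum _ λ i → subst (p ∣_) (sym (×≡* (p C suc (toℕ (inject₁ i))) (binomial x 1 p (suc (inject₁ i)))))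
      (ℕ.∣m⇒∣m*n _ (p∣pCk p-prime (s≤s z≤n) (s≤s (subst (_< n) (sym (toℕ-inject₁ i)) (toℕ<n i)))))
    first : T zero ≡ 1
    first = trans (×≡* 1 _) (trans (ℕ.*-identityˡ _) (trans (ℕ.*-identityˡ _) (trans (^≡^ 1 p) (ℕ.^-zeroˡ p))))
    last : T (suc (fromℕ n)) ≡ x ^ p
    last rewrite toℕ-fromℕ n | nCn≡1 p | ℕ.n∸n≡0 n =
      trans (×≡* 1 _) (trans (ℕ.*-identityˡ _) (trans (ℕ.*-identityʳ _) (^≡^ x p)))

module MonicPolynomials where

  open import Data.Integer using (ℤ; 0ℤ; 1ℤ; -1ℤ; _+_; _-_; _*_; _^_)
  open import Data.Integer.Properties using (+-identityˡ; +-comm)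
  import Data.Integer.Tactic.RingSolver as ℤ
  open import Data.List using (List; []; _∷_; length; replicate)
  open import Relation.Binary.PropositionalEquality using (refl; trans; cong; module ≡-Reasoning)

  -- monic (c₀ ∷ c₁ ∷ ⋯ ∷ cₙ₋₁ ∷ []) y = c₀ + y (c₁ + ⋯ + y (cₙ₋₁ + y)), a monic polynomial of degree n.
  monic : List ℤ → ℤ → ℤ
  monic []       y = 1ℤ
  monic (c ∷ cs) y = c + y * monic cs y

  divide : ℤ → List ℤ → List ℤ
  divide r []       = []
  divide r (d ∷ ds) = monic (d ∷ ds) r ∷ divide r ds

  length-divide : ∀ r cs → length (divide r cs) ≡ length cs
  length-divide r []       = refl
  length-divide r (d ∷ ds) = cong suc (length-divide r ds)

  monic-factor : ∀ r c cs y → monic (c ∷ cs) y - monic (c ∷ cs) r ≡ (y - r) * monic (divide r cs) y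
  monic-factor r c []       y = linear r c y
    where
    linear : ∀ r c y → c + y * 1ℤ - (c + r * 1ℤ) ≡ (y - r) * 1ℤ
    linear = ℤ.solve-∀
  monic-factor r c (d ∷ ds) y = begin
    c + y * g y - (c + r * g r)      ≡⟨ regroup c y r (g y) (g r) ⟩
    y * (g y - g r) + (y - r) * g r  ≡⟨ cong (λ z → y * z + (y - r) * g r) (monic-factor r d ds y) ⟩
    y * ((y - r) * q) + (y - r) * g r ≡⟨ factor y r q (g r) ⟩
    (y - r) * (g r + y * q)          ∎
    where
    open ≡-Reasoning
    g : ℤ → ℤ
    g = monic (d ∷ ds)
    q : ℤ
    q = monic (divide r ds) y
    regroup : ∀ c y r gy gr → c + y * gy - (c + r * gr) ≡ y * (gy - gr) + (y - r) * gr
    regroup = ℤ.solve-∀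
    factor : ∀ y r q gr → y * ((y - r) * q) + (y - r) * gr ≡ (y - r) * (gr + y * q)
    factor = ℤ.solve-∀

  monic-x^[1+n]-1 : ∀ n y → monic (-1ℤ ∷ replicate n 0ℤ) y ≡ y ^ suc n - 1ℤ
  monic-x^[1+n]-1 n y = trans (cong (λ z → -1ℤ + y * z) (powers n)) (+-comm -1ℤ (y * y ^ n))
    where
    powers : ∀ n → monic (replicate n 0ℤ) y ≡ y ^ n
    powers zero    = refl
    powers (suc n) = trans (+-identityˡ _) (cong (y *_) (powers n))

module ModPrime {p} (p-prime : Prime p) where

  open import Data.Nat as ℕ using (_≤_; z≤n; s≤s)
  import Data.Nat.Properties as ℕ
  import Data.Nat.Divisibility as ℕ
  open import Data.Nat.Primality using (euclidsLemma; prime⇒nonTrivial; prime⇒nonZero)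
  open import Data.Integer using (ℤ; +_; 0ℤ; 1ℤ; -_; _+_; _-_; _*_; _^_; ∣_∣)
  open import Data.Integer.Properties using (abs-*)
  open import Data.Integer.Divisibility.Signed using (∣⇒∣ᵤ; ∣ᵤ⇒∣)
  import Data.Integer.Tactic.RingSolver as ℤ
  open import Data.List using ([]; _∷_; length)
  open import Data.List.Relation.Unary.All using (All; []; _∷_)
  open import Data.List.Relation.Unary.AllPairs using (AllPairs; []; _∷_)
  open import Data.Sum using (_⊎_; map; [_,_])
  open import Function using (_∘_)
  open import Relation.Binary.PropositionalEquality using (sym; trans; cong; subst)
  open import Relation.Nullary using (contradiction)
  open IntegerArithmetic
  open Congruence p
  open BinomialCoefficients using ([1+x]^p≡1+x^p)
  open MonicPolynomials

  1≉0 : 1ℤ ≉ 0ℤ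
  1≉0 1≈0 = ℕ.<-irrefl (sym (ℕ.∣1⇒≡1 (∣⇒∣ᵤ (≈0⇒∣ 1≈0)))) (ℕ.nonTrivial⇒n>1 p {{prime⇒nonTrivial p-prime}})

  i*j≈0⇒i≈0∨j≈0 : ∀ {a b} → a * b ≈ 0ℤ → a ≈ 0ℤ ⊎ b ≈ 0ℤ
  i*j≈0⇒i≈0∨j≈0 {a} {b} ab≈0 =
    map (∣⇒≈0 ∘ ∣ᵤ⇒∣) (∣⇒≈0 ∘ ∣ᵤ⇒∣)
        (euclidsLemma ∣ a ∣ ∣ b ∣ p-prime (subst (ℕ._∣_ p) (abs-* a b) (∣⇒∣ᵤ (≈0⇒∣ ab≈0))))

  x^p≈x : ∀ x → (+ x) ^ p ≈ + x
  x^p≈x zero    = ≈-reflexive (0^n≡0 p {{prime⇒nonZero p-prime}})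
  x^p≈x (suc x) = begin
    (+ suc x) ^ p             ≡⟨ pos-^ (suc x) p ⟨
    + (suc x ℕ.^ p)           ≈⟨ mod⇒≈ ([1+x]^p≡1+x^p p-prime x) ⟩
    1ℤ + + (x ℕ.^ p)          ≡⟨ cong (λ y → 1ℤ + y) (pos-^ x p) ⟩
    1ℤ + (+ x) ^ p            ≈⟨ +-cong (≈-refl {1ℤ}) (x^p≈x x) ⟩
    1ℤ + + x                  ∎
    where open import Relation.Binary.Reasoning.Setoid ≈-setoid

  x^[p-1]≈1 : ∀ x → + x ≉ 0ℤ → (+ x) ^ (p ℕ.∸ 1) ≈ 1ℤ
  x^[p-1]≈1 x x≉0 = [ (λ x≈0 → contradiction x≈0 x≉0) , -≈0⇒≈ ] (i*j≈0⇒i≈0∨j≈0 x*[x^[p-1]-1]≈0)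
    where
    factor : ∀ x y → x * (y - 1ℤ) ≡ x * y - x
    factor = ℤ.solve-∀
    x*[x^[p-1]-1]≈0 : + x * ((+ x) ^ ℕ.pred p - 1ℤ) ≈ 0ℤ
    x*[x^[p-1]-1]≈0 = subst (_≈ 0ℤ)
      (sym (trans (factor (+ x) _) (cong (λ n → (+ x) ^ n - + x) (ℕ.suc-pred p {{prime⇒nonZero p-prime}}))))
      (≈⇒-≈0 (x^p≈x x))

  length-roots≤degree : ∀ cs rs → AllPairs _≉_ rs → All (λ r → monic cs r ≈ 0ℤ) rs → length rs ≤ length cs
  length-roots≤degree cs       []       _              _               = z≤n
  length-roots≤degree []       (r ∷ rs) _              (1≈0 ∷ _)       = contradiction 1≈0 1≉0
  length-roots≤degree (c ∷ cs) (r ∷ rs) (r≉rs ∷ distinct) (fr≈0 ∷ frs≈0) =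
    s≤s (subst (length rs ≤_) (length-divide r cs) (length-roots≤degree (divide r cs) rs distinct (quotient-roots r≉rs frs≈0)))
    where
    quotient-roots : ∀ {ss} → All (r ≉_) ss → All (λ s → monic (c ∷ cs) s ≈ 0ℤ) ss →
                     All (λ s → monic (divide r cs) s ≈ 0ℤ) ss
    quotient-roots []           []             = []
    quotient-roots {s ∷ _} (r≉s ∷ r≉ss) (fs≈0 ∷ fss≈0) =
      [ (λ s-r≈0 → contradiction (≈-sym (-≈0⇒≈ s-r≈0)) r≉s) , (λ q≈0 → q≈0) ]
        (i*j≈0⇒i≈0∨j≈0 (subst (_≈ 0ℤ) (monic-factor r c cs s) (+-cong fs≈0 (-‿cong fr≈0))))
      ∷ quotient-roots r≉ss fss≈0

module HalfRoots {p} (p-prime : Prime p) (m : ℕ) (p≡1+2m : p ≡ suc (2 ℕ.* m)) (h : ℕ) .{{_ : NonZero h}} where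

  open import Data.Nat as ℕ using (_≤_; _<_; z≤n; s≤s)
  import Data.Nat.Properties as ℕ
  open import Data.Nat.Primality using (prime⇒nonZero)
  open import Data.Nat.DivMod using (_%_; m%n<n)
  open import Data.Integer using (ℤ; +_; 0ℤ; 1ℤ; -1ℤ; -_; _+_; _-_; _*_; _^_)
  open import Data.Integer.Properties using (neg-involutive; +-identityˡ; pos-+; +-inverseˡ)
  open import Data.List using (List; _∷_; map; _++_; length; filter; applyUpTo; replicate)
  open import Data.List.Properties using (length-++; length-map; length-replicate)
  open import Data.List.Membership.Propositional using (_∈_)
  open import Data.List.Membership.Propositional.Properties using (∈-filter⁺; ∈-filter⁻; ∈-applyUpTo⁺; ∈-applyUpTo⁻)
  open import Data.List.Relation.Unary.All as All using (All)
  import Data.List.Relation.Unary.All.Properties as All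
  open import Data.List.Relation.Unary.AllPairs as AllPairs using (AllPairs)
  import Data.List.Relation.Unary.AllPairs.Properties as AllPairs
  open import Data.Product using (∃; _×_; _,_; proj₁; proj₂; map₂)
  open import Data.Sum as Sum using (_⊎_; inj₁; inj₂)
  open import Function using (_∘_)
  open import Relation.Binary.PropositionalEquality using (refl; sym; trans; cong; cong₂; subst; subst₂)
  open import Relation.Nullary using (¬_; yes; no)
  open import Relation.Unary using (Decidable)
  open IntegerArithmetic
  open Congruence p
  open MonicPolynomials
  open ModPrime p-prime

  private
    instance
      2h≢0 : NonZero (2 ℕ.* h)
      2h≢0 = ℕ.m*n≢0 2 h

  Root : ℕ → Set
  Root y = (+ y) ^ (2 ℕ.* h) ≈ 1ℤ

  Root? : Decidable Root
  Root? y = (+ y) ^ (2 ℕ.* h) ≈? 1ℤ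

  smallRoots : List ℕ
  smallRoots = filter Root? (applyUpTo suc m)

  Root-neg : ∀ {u} → Root u → (- + u) ^ (2 ℕ.* h) ≈ 1ℤ
  Root-neg {u} = subst (_≈ 1ℤ) (sym (-i^[2n]≡i^[2n] (+ u) h))

  ∈smallRoots⁻ : ∀ {u} → u ∈ smallRoots → (1 ≤ u × u ≤ m) × Root u
  ∈smallRoots⁻ u∈ with ∈-filter⁻ Root? {xs = applyUpTo suc m} u∈
  ... | u∈range , root with ∈-applyUpTo⁻ suc {n = m} u∈range
  ...   | i , i<m , refl = (s≤s z≤n , i<m) , root

  ∈smallRoots⁺ : ∀ {u} → 1 ≤ u → u ≤ m → Root u → u ∈ smallRoots
  ∈smallRoots⁺ {suc i} _ i<m root = ∈-filter⁺ Root? (∈-applyUpTo⁺ suc i<m) root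

  ≤m⇒<p : ∀ {a} → a ≤ m → a < p
  ≤m⇒<p a≤m = subst (_ <_) (sym p≡1+2m) (s≤s (ℕ.≤-trans a≤m (ℕ.m≤n*m m 2)))

  +≉+ : ∀ {a b} → a < b → b ≤ m → + a ≉ + b
  +≉+ a<b b≤m a≈b = ℕ.<⇒≢ a<b (≈⇒≡ (ℕ.<-trans a<b (≤m⇒<p b≤m)) (≤m⇒<p b≤m) a≈b)

  +≉- : ∀ {a b} → 1 ≤ a → a ≤ m → b ≤ m → + a ≉ - + b
  +≉- {a} {b} 1≤a a≤m b≤m a≈-b =
    ℕ.<⇒≢ (ℕ.≤-trans 1≤a (ℕ.m≤m+n a b)) (sym (≈⇒≡ a+b<p (≤m⇒<p z≤n) a+b≈0))
    where
    a+b<p : a ℕ.+ b < p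
    a+b<p = subst (_ <_) (sym p≡1+2m)
              (s≤s (subst (a ℕ.+ b ≤_) (cong (m ℕ.+_) (sym (ℕ.+-identityʳ m))) (ℕ.+-mono-≤ a≤m b≤m)))
    a+b≈0 : + (a ℕ.+ b) ≈ 0ℤ
    a+b≈0 = ≈-trans (≈-reflexive (pos-+ a b)) (≈-trans (+-cong a≈-b ≈-refl) (≈-reflexive (+-inverseˡ (+ b))))

  ±smallRoots : List ℤ
  ±smallRoots = map +_ smallRoots ++ map (-_ ∘ +_) smallRoots

  ±smallRoots-distinct : AllPairs _≉_ ±smallRoots
  ±smallRoots-distinct = AllPairs.++⁺ (AllPairs.map⁺ (AllPairs.map (λ (a<b , b≤m) → +≉+ a<b b≤m) increasing))
                            (AllPairs.map⁺ (AllPairs.map (λ (a<b , b≤m) → +≉+ a<b b≤m ∘ neg-cancel) increasing))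
                            (All.map⁺ (All.tabulate λ a∈ → All.map⁺ (All.tabulate (cross a∈))))
    where
    cross : ∀ {a b} → a ∈ smallRoots → b ∈ smallRoots → + a ≉ - + b
    cross a∈ b∈ = let ((1≤a , a≤m) , _) = ∈smallRoots⁻ a∈
                      ((_ , b≤m) , _)   = ∈smallRoots⁻ b∈
                  in +≉- 1≤a a≤m b≤m
    increasing : AllPairs (λ a b → a < b × b ≤ m) smallRoots
    increasing = AllPairs.filter⁺ Root? (AllPairs.applyUpTo⁺₁ suc m (λ i<j j<m → s≤s i<j , j<m))
    neg-cancel : ∀ {a b} → - a ≈ - b → a ≈ b
    neg-cancel {a} {b} = subst₂ _≈_ (neg-involutive a) (neg-involutive b) ∘ -‿cong

  x²ʰ-1 : List ℤ
  x²ʰ-1 = -1ℤ ∷ replicate (ℕ.pred (2 ℕ.* h)) 0ℤ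

  ±smallRoots-roots : All (λ r → monic x²ʰ-1 r ≈ 0ℤ) ±smallRoots
  ±smallRoots-roots = All.++⁺ (All.map⁺ (All.tabulate (xⁿ-1≈0 ∘ proj₂ ∘ ∈smallRoots⁻)))
                    (All.map⁺ (All.tabulate (xⁿ-1≈0 ∘ Root-neg ∘ proj₂ ∘ ∈smallRoots⁻)))
    where
    xⁿ-1≈0 : ∀ {r} → r ^ (2 ℕ.* h) ≈ 1ℤ → monic x²ʰ-1 r ≈ 0ℤ
    xⁿ-1≈0 {r} r^2h≈1 = subst (_≈ 0ℤ) (sym eq) (≈⇒-≈0 r^2h≈1)
      where
      eq : monic x²ʰ-1 r ≡ r ^ (2 ℕ.* h) - 1ℤ
      eq = trans (monic-x^[1+n]-1 (ℕ.pred (2 ℕ.* h)) r) (cong (λ n → r ^ n - 1ℤ) (ℕ.suc-pred (2 ℕ.* h)))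

  length-smallRoots≤h : length smallRoots ≤ h
  length-smallRoots≤h = ℕ.*-cancelˡ-≤ 2 (subst₂ _≤_ length-±smallRoots length-poly
    (length-roots≤degree x²ʰ-1 ±smallRoots ±smallRoots-distinct ±smallRoots-roots))
    where
    length-poly : length x²ʰ-1 ≡ 2 ℕ.* h
    length-poly = trans (cong suc (length-replicate (ℕ.pred (2 ℕ.* h)))) (ℕ.suc-pred (2 ℕ.* h))
    length-±smallRoots : length ±smallRoots ≡ 2 ℕ.* length smallRoots
    length-±smallRoots = trans (length-++ (map +_ smallRoots))
      (cong₂ ℕ._+_ (length-map +_ smallRoots) (trans (length-map (-_ ∘ +_) smallRoots) (sym (ℕ.+-identityʳ _))))

  ¬Root0 : ¬ Root 0
  ¬Root0 0≈1 = 1≉0 (≈-sym (subst (_≈ 1ℤ) (0^n≡0 (2 ℕ.* h)) 0≈1))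

  residue⇒±smallRoot : ∀ {r} → Root r → r < p → ∃ λ u → u ∈ smallRoots × (+ r ≈ + u ⊎ + r ≈ - + u)
  residue⇒±smallRoot {r} root r<p with r ℕ.≤? m
  ... | yes r≤m = r , ∈smallRoots⁺ (ℕ.n≢0⇒n>0 λ { refl → ¬Root0 root }) r≤m root , inj₁ ≈-refl
  ... | no  r≰m = p ℕ.∸ r , ∈smallRoots⁺ (ℕ.m<n⇒0<n∸m r<p) p-r≤m root-p-r , inj₂ r≈-[p-r]
    where
    p-r≤m : p ℕ.∸ r ≤ m
    p-r≤m = ℕ.≤-trans (ℕ.∸-monoʳ-≤ p (ℕ.≰⇒> r≰m))
                      (ℕ.≤-reflexive (trans (cong (ℕ._∸ suc m) p≡1+2m) (trans (ℕ.m+n∸m≡n m (m ℕ.+ 0)) (ℕ.+-identityʳ m))))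
    p-r≈-r : + (p ℕ.∸ r) ≈ - + r
    p-r≈-r = begin
      + (p ℕ.∸ r)   ≡⟨ pos-∸ (ℕ.<⇒≤ r<p) ⟨
      + p - + r     ≈⟨ +-cong p≈0 (≈-refl { - + r}) ⟩
      0ℤ + - + r    ≡⟨ +-identityˡ (- + r) ⟩
      - + r         ∎
      where open import Relation.Binary.Reasoning.Setoid ≈-setoid
    root-p-r : Root (p ℕ.∸ r)
    root-p-r = ≈-trans (^-cong (2 ℕ.* h) p-r≈-r) (Root-neg root)
    r≈-[p-r] : + r ≈ - + (p ℕ.∸ r)
    r≈-[p-r] = subst (_≈ - + (p ℕ.∸ r)) (neg-involutive (+ r)) (≈-sym (-‿cong p-r≈-r))

  root⇒±smallRoot : ∀ {y} → Root y → ∃ λ u → u ∈ smallRoots × (+ y ≈ + u ⊎ + y ≈ - + u)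
  root⇒±smallRoot {y} root = map₂ (map₂ (Sum.map (≈-trans y≈r) (≈-trans y≈r)))
                                  (residue⇒±smallRoot (≈-trans (^-cong (2 ℕ.* h) (≈-sym y≈r)) root) (m%n<n y p))
    where
    instance _ = prime⇒nonZero p-prime
    y≈r : + y ≈ + (y % p)
    y≈r = ≈-sym (%-≈ y)

module LatticeCovering (p : ℕ) where

  open import Data.Nat as ℕ using (_≤_; _<_)
  import Data.Nat.Properties as ℕ
  open import Data.Integer using (ℤ; +_; _+_; _*_; ∣_∣)
  open import Data.Integer.Properties using (+-comm)
  open import Data.Fin using (Fin; toℕ)
  open import Data.Fin.Properties using (toℕ<n; toℕ-injective; injective⇒≤)
  open import Data.List using (length; lookup)
  open import Data.List.Relation.Unary.Any using (index)
  open import Data.List.Relation.Unary.Any.Properties using (lookup-index)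
  open import Data.Vec using (Vec; updateAt)
  open import Data.Product using (∃; _×_; _,_; proj₁; proj₂)
  open import Relation.Binary.PropositionalEquality using (sym; trans; cong; subst)
  open LatticePointCount using (ballSize)
  open IntegerVectors
  open IntegerArithmetic
  open Congruence p

  add-unit-multiple : ∀ {n a} (u : Fin n → ℤ) (c : Vec ℤ n) i s → ∣ s ∣ ≡ 1 → a ≈ s * u i →
                      ∃ λ c′ → norm₁ c′ ≤ suc (norm₁ c) × a + combination c u ≈ combination c′ u
  add-unit-multiple {a = a} u c i s ∣s∣≡1 a≈su = updateAt c i (_+ s) , bound , (begin
    a + combination c u                 ≈⟨ +-cong a≈su ≈-refl ⟩
    s * u i + combination c u           ≡⟨ +-comm (s * u i) _ ⟩
    combination c u + s * u i           ≡⟨ combination-updateAt c i s u ⟨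
    combination (updateAt c i (_+ s)) u ∎)
    where
    open import Relation.Binary.Reasoning.Setoid ≈-setoid
    bound : norm₁ (updateAt c i (_+ s)) ≤ suc (norm₁ c)
    bound = ℕ.≤-trans (norm₁-updateAt c i s)
                      (ℕ.≤-reflexive (trans (cong (norm₁ c ℕ.+_) ∣s∣≡1) (ℕ.+-comm (norm₁ c) 1)))

  covering⇒p≤ballSize : ∀ {n G} (u : Fin n → ℤ) →
                         (∀ a → a < p → ∃ λ c → norm₁ c ≤ G × + a ≈ combination c u) → p ≤ ballSize n G
  covering⇒p≤ballSize {n} {G} u cover = subst (p ≤_) (length-ball n G) (injective⇒≤ f-injective)
    where
    rep : (a : Fin p) → ∃ λ c → norm₁ c ≤ G × + toℕ a ≈ combination c u
    rep a = cover (toℕ a) (toℕ<n a)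
    f : Fin p → Fin (length (ball n G))
    f a = index (∈-ball (proj₁ (rep a)) (proj₁ (proj₂ (rep a))))
    f-injective : ∀ {a b} → f a ≡ f b → a ≡ b
    f-injective {a} {b} fa≡fb = toℕ-injective (≈⇒≡ (toℕ<n a) (toℕ<n b) (begin
      + toℕ a                         ≈⟨ proj₂ (proj₂ (rep a)) ⟩
      combination (proj₁ (rep a)) u   ≡⟨ cong (λ c → combination c u) same-vector ⟩
      combination (proj₁ (rep b)) u   ≈⟨ proj₂ (proj₂ (rep b)) ⟨
      + toℕ b                         ∎))
      where
      open import Relation.Binary.Reasoning.Setoid ≈-setoid
      same-vector : proj₁ (rep a) ≡ proj₁ (rep b)
      same-vector = trans (lookup-index (∈-ball (proj₁ (rep a)) _))
                          (trans (cong (lookup (ball n G)) fa≡fb) (sym (lookup-index (∈-ball (proj₁ (rep b)) _))))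

module Waring {p k h} (p-prime : Prime p) (1≤h : 1 ℕ.≤ h) (k*2h≡p-1 : k ℕ.* (2 ℕ.* h) ≡ p ℕ.∸ 1) where

  open import Data.Nat as ℕ using (_≤_; _<_; s≤s; >-nonZero)
  import Data.Nat.Properties as ℕ
  open import Data.Nat.Tactic.RingSolver using (solve-∀)
  open import Data.Nat.Primality using (prime⇒nonZero; prime⇒nonTrivial)
  open import Data.Integer using (ℤ; +_; 0ℤ; 1ℤ; _+_; _*_; _^_)
  open import Data.Integer.Properties using (pos-+; +-identityˡ; ^-*-assoc)
  open import Data.Fin using (Fin)
  open import Data.List using (length; lookup)
  open import Data.List.Relation.Unary.Any using (index)
  open import Data.List.Relation.Unary.Any.Properties using (lookup-index)
  open import Data.Vec using (Vec; []; _∷_; replicate)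
  import Data.Vec as Vec
  open import Data.Product using (∃; _×_; _,_)
  open import Data.Sum using (_⊎_; inj₁; inj₂; [_,_]′)
  open import Relation.Binary.PropositionalEquality using (sym; trans; cong; subst)
  open import Relation.Nullary using (yes; no)
  open import Defs using (EveryElementSumOf)
  open LatticePointCount using (ballSize; ballSize-monoˡ)
  open IntegerVectors
  open IntegerArithmetic
  open Congruence p
  open ModPrime p-prime
  open LatticeCovering p

  private
    m : ℕ
    m = k ℕ.* h

    p≡1+2m : p ≡ suc (2 ℕ.* m)
    p≡1+2m = trans (sym (ℕ.m+[n∸m]≡n (ℕ.>-nonZero⁻¹ p {{prime⇒nonZero p-prime}})))
                   (cong suc (trans (sym k*2h≡p-1) (reassoc k h)))
      where
      reassoc : ∀ k h → k ℕ.* (2 ℕ.* h) ≡ 2 ℕ.* (k ℕ.* h)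
      reassoc = solve-∀

    instance
      h≢0 : NonZero h
      h≢0 = >-nonZero 1≤h

  open HalfRoots p-prime m p≡1+2m h

  private
    instance
      k≢0 : NonZero k
      k≢0 = ℕ.m*n≢0⇒m≢0 k {{subst NonZero (sym k*2h≡p-1)
              (>-nonZero (ℕ.m<n⇒0<n∸m (ℕ.nonTrivial⇒n>1 p {{prime⇒nonTrivial p-prime}})))}}

  power≈0∨root : ∀ x → + (x ℕ.^ k) ≈ 0ℤ ⊎ Root (x ℕ.^ k)
  power≈0∨root x with + x ≈? 0ℤ
  ... | yes x≈0 = inj₁ (begin
    + (x ℕ.^ k)      ≡⟨ pos-^ x k ⟩
    (+ x) ^ k        ≈⟨ ^-cong k x≈0 ⟩
    0ℤ ^ k           ≡⟨ 0^n≡0 k ⟩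
    0ℤ               ∎)
    where open import Relation.Binary.Reasoning.Setoid ≈-setoid
  ... | no  x≉0 = inj₂ (begin
    (+ (x ℕ.^ k)) ^ (2 ℕ.* h)  ≡⟨ cong (_^ (2 ℕ.* h)) (pos-^ x k) ⟩
    ((+ x) ^ k) ^ (2 ℕ.* h)    ≡⟨ ^-*-assoc (+ x) k (2 ℕ.* h) ⟩
    (+ x) ^ (k ℕ.* (2 ℕ.* h))  ≡⟨ cong ((+ x) ^_) k*2h≡p-1 ⟩
    (+ x) ^ (p ℕ.∸ 1)          ≈⟨ x^[p-1]≈1 x x≉0 ⟩
    1ℤ                         ∎)
    where open import Relation.Binary.Reasoning.Setoid ≈-setoid

  smallRoot : Fin (length smallRoots) → ℤ
  smallRoot i = + lookup smallRoots i

  add-power : ∀ x (c : Vec ℤ (length smallRoots)) →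
              ∃ λ c′ → norm₁ c′ ≤ suc (norm₁ c) × + (x ℕ.^ k) + combination c smallRoot ≈ combination c′ smallRoot
  add-power x c = [ vanishing , nonvanishing ]′ (power≈0∨root x)
    where
    Goal : Set
    Goal = ∃ λ c′ → norm₁ c′ ≤ suc (norm₁ c) × + (x ℕ.^ k) + combination c smallRoot ≈ combination c′ smallRoot
    vanishing : + (x ℕ.^ k) ≈ 0ℤ → Goal
    vanishing x^k≈0 = c , ℕ.n≤1+n _ , ≈-trans (+-cong x^k≈0 (≈-refl {combination c smallRoot})) (≈-reflexive (+-identityˡ _))
    nonvanishing : Root (x ℕ.^ k) → Goal
    nonvanishing root =
      let (v , v∈ , ±v) = root⇒±smallRoot root
          (s , ∣s∣≡1 , x^k≈sv) = ±⇒unit-multiple ±v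
      in add-unit-multiple smallRoot c (index v∈) s ∣s∣≡1 (subst (λ w → _ ≈ s * + w) (lookup-index v∈) x^k≈sv)

  sum-of-powers : ∀ {g} (xs : Vec ℕ g) →
                  ∃ λ c → norm₁ c ≤ g × + Vec.sum (Vec.map (λ y → y ℕ.^ k) xs) ≈ combination c smallRoot
  sum-of-powers [] = replicate n 0ℤ , ℕ.≤-reflexive (norm₁-replicate-0 n) ,
                     ≈-reflexive (sym (combination-replicate-0 n smallRoot))
    where
    n = length smallRoots
  sum-of-powers (x ∷ xs) =
    let (c , c≤g , S≈c) = sum-of-powers xs
        (c′ , c′≤ , x^k+c≈c′) = add-power x c
    in c′ , ℕ.≤-trans c′≤ (s≤s c≤g) ,
       ≈-trans (≈-reflexive (pos-+ (x ℕ.^ k) _)) (≈-trans (+-cong (≈-refl {+ (x ℕ.^ k)}) S≈c) x^k+c≈c′)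

  every⇒p≤ballSize : ∀ {g} → EveryElementSumOf k p g → p ≤ ballSize h g
  every⇒p≤ballSize {g} every = ℕ.≤-trans (covering⇒p≤ballSize smallRoot cover) (ballSize-monoˡ g length-smallRoots≤h)
    where
    cover : ∀ a → a < p → ∃ λ c → norm₁ c ≤ g × + a ≈ combination c smallRoot
    cover a a<p =
      let (xs , sum≡a) = every a a<p
          (c , c≤g , sum≈c) = sum-of-powers xs
      in c , c≤g , ≈-trans (≈-sym (mod⇒≈ sum≡a)) sum≈c


open LatticePointCount using (ballSize; n!*ballSize≤[2G+n+1]^n)
open import Defs
open import Data.Nat using (ℕ; _+_; _*_; _^_; _∸_; _≤_)
open import Data.Nat.Primality using (Prime)
open import Data.Nat using (_!)
open import Relation.Binary.PropositionalEquality using (_≡_; _≢_)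
open import Data.Product using (_,_)
import Data.Nat.Properties as ℕ

proposition7p1 : (p h k g : ℕ) → Prime p → p ≢ 2 → 1 ≤ h
    → k * (2 * h) ≡ p ∸ 1 → IsWaringNumber k p g
    → (h !) * p ≤ (2 * g + h + 1) ^ h
proposition7p1 p h k g p-prime _ 1≤h k*2h≡p-1 (_ , every , _) = begin
  h ! * p                ≤⟨ ℕ.*-monoʳ-≤ (h !) (Waring.every⇒p≤ballSize {k = k} p-prime 1≤h k*2h≡p-1 every) ⟩
  h ! * ballSize h g     ≤⟨ n!*ballSize≤[2G+n+1]^n h g ⟩
  (2 * g + h + 1) ^ h    ∎
  where open ℕ.≤-Reasoning
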